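{- Let $p$ be a prime and let $M = p^{a}$, $N = p^{b}$ with integers $a,b \ge 1$. Then the sequence $b(n) = \mathcal{B}_{M,N}(n) \bmod M$ ($n \ge 0$) is purely periodic, and its minimal period is $P_{\min} = p^{e}$, where $t = \lceil a/b \rceil$ and $e = at - b(t-1)$.
   Context: For integers $M\ge 2$, $N \ge 1$ and $n\ge 0$ with base-$M$ expansion $n=\sum_{i\ge 0} d_i(n) M^i$, $d_i(n)\in\{0,\dots,M-1\}$, the base-shifting map is $\mathcal{B}_{M,N}(n) := \sum_{i\ge 0} d_i(n) N^i$. -}

module Defs where

open import Data.Nat using (ℕ; zero; suc; _+_; _*_; _∸_; _^_; _≤_; NonZero)
open import Data.Nat.DivMod using (_/_; _%_)
open import Data.Product using (_×_)
open import Relation.Binary.PropositionalEquality using (_≡_)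

baseShiftFuel : (M N : ℕ) → .{{_ : NonZero M}} → ℕ → ℕ → ℕ
baseShiftFuel M N zero    n = 0
baseShiftFuel M N (suc f) n = n % M + N * baseShiftFuel M N f (n / M)

-- B_{M,N}(n) = Σ d_i(n) N^i.  Since M ≥ 2, n has at most n base-M digits,
-- so fuel n suffices (digits beyond are all 0).
baseShift : (M N : ℕ) → .{{_ : NonZero M}} → ℕ → ℕ
baseShift M N n = baseShiftFuel M N n n

IsPeriod : (ℕ → ℕ) → ℕ → Set
IsPeriod f P = (1 ≤ P) × (∀ n → f (n + P) ≡ f n)

IsMinimalPeriod : (ℕ → ℕ) → ℕ → Set
IsMinimalPeriod f P = IsPeriod f P × (∀ Q → IsPeriod f Q → P ≤ Q)

ceilDiv : (a b : ℕ) → .{{_ : NonZero b}} → ℕ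
ceilDiv a b = (a + b ∸ 1) / b

-- Write a = k * b + (1 + r) with r < b, so that t = k + 1 and e = k * a + 1 + r.
-- Base shifting moves the i-th base-p^a digit of n to the i-th base-p^b place, so
-- B(n) mod p ^ a = p ^ (k * b) * p ^ (1 + r) depends only on the first k digits of n
-- and on the next one modulo p ^ (1 + r), i.e. on n mod p ^ e: hence p ^ e is a period.
-- The gcd of two periods is a period, so every period is a multiple of p ^ e unless
-- p ^ (e - 1) is a period; but B(p ^ (e - 1)) = p ^ (k * b + r) is nonzero modulo p ^ a
-- while B(0) = 0.
module Submission where

open import Defs
open import Data.Nat.Base
  using (ℕ; zero; suc; _+_; _*_; _∸_; _^_; _≤_; _<_; _%_; _/_; z≤n; s≤s;
         NonZero; >-nonZero; >-nonZero⁻¹; nonTrivial⇒n>1)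
open import Data.Nat.Properties
open import Data.Nat.DivMod
open import Data.Nat.Divisibility
open import Data.Nat.GCD using (gcd; gcd[m,n]∣m; gcd[m,n]∣n; gcd-GCD; module Bézout)
open import Data.Nat.Primality using (Prime; prime⇒nonZero; prime⇒nonTrivial; euclidsLemma)
open import Data.Nat.Solver using (module +-*-Solver)
open import Data.Product using (_,_)
open import Data.Sum using (_⊎_; inj₁; inj₂)
open import Relation.Nullary using (contradiction)
open import Relation.Binary.PropositionalEquality
open +-*-Solver using (solve; _:*_; _:+_; con; _:=_)

Periodic : (ℕ → ℕ) → ℕ → Set
Periodic f P = ∀ n → f (n + P) ≡ f n

module _ {f : ℕ → ℕ} where

  periodic-* : ∀ {P} → Periodic f P → ∀ c → Periodic f (c * P)
  periodic-*     _   zero    n = cong f (+-identityʳ n)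
  periodic-* {P} per (suc c) n = begin
    f (n + (P + c * P))  ≡⟨ cong f (trans (+-assoc n (c * P) P) (cong (n +_) (+-comm (c * P) P))) ⟨
    f (n + c * P + P)    ≡⟨ per (n + c * P) ⟩
    f (n + c * P)        ≡⟨ periodic-* per c n ⟩
    f n                  ∎
    where open ≡-Reasoning

  -- Bézout: gcd Q P + y * P ≡ x * Q (or symmetrically), so shifting by gcd Q P
  -- and then by y * P is the same as shifting by x * Q.
  periodic-gcd : ∀ {Q P} → Periodic f Q → Periodic f P → Periodic f (gcd Q P)
  periodic-gcd {Q} {P} perQ perP n with Bézout.identity (gcd-GCD Q P)
  ... | Bézout.+- x y eq = begin
    f (n + gcd Q P)            ≡⟨ periodic-* perP y (n + gcd Q P) ⟨
    f (n + gcd Q P + y * P)    ≡⟨ cong f (trans (+-assoc n _ _) (cong (n +_) eq)) ⟩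
    f (n + x * Q)              ≡⟨ periodic-* perQ x n ⟩
    f n                        ∎
    where open ≡-Reasoning
  ... | Bézout.-+ x y eq = begin
    f (n + gcd Q P)            ≡⟨ periodic-* perQ x (n + gcd Q P) ⟨
    f (n + gcd Q P + x * Q)    ≡⟨ cong f (trans (+-assoc n _ _) (cong (n +_) eq)) ⟩
    f (n + y * P)              ≡⟨ periodic-* perP y n ⟩
    f n                        ∎
    where open ≡-Reasoning

module _ {p : ℕ} (prime-p : Prime p) where

  primePower-cofactor : ∀ e {d c} → d * c ≡ p ^ e → c ≡ 1 ⊎ p ∣ c
  primePower-cofactor zero    {d} {c} dc≡1 = inj₁ (m*n≡1⇒n≡1 d c dc≡1)
  primePower-cofactor (suc e) {d} {c} dc≡p^[1+e]
    with euclidsLemma d c prime-p (divides (p ^ e) (trans dc≡p^[1+e] (*-comm p (p ^ e))))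
  ... | inj₂ p∣c              = inj₂ p∣c
  ... | inj₁ (divides-refl q) = primePower-cofactor e {q}
          (*-cancelˡ-≡ (q * c) (p ^ e) p {{prime⇒nonZero prime-p}}
            (trans (sym (*-assoc p q c)) (trans (cong (_* c) (*-comm p q)) dc≡p^[1+e])))

  ∣p^[1+e]⇒≡p^[1+e]⊎∣p^e : ∀ {d e} → d ∣ p ^ suc e → d ≡ p ^ suc e ⊎ d ∣ p ^ e
  ∣p^[1+e]⇒≡p^[1+e]⊎∣p^e {d} {e} (divides c p^[1+e]≡cd)
    with primePower-cofactor (suc e) {d} {c} (trans (*-comm d c) (sym p^[1+e]≡cd))
  ... | inj₁ refl              = inj₁ (sym (trans p^[1+e]≡cd (*-identityˡ d)))
  ... | inj₂ (divides-refl c′) = inj₂ (divides c′ (*-cancelˡ-≡ (p ^ e) (c′ * d) p {{prime⇒nonZero prime-p}}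
          (trans p^[1+e]≡cd (trans (cong (_* d) (*-comm c′ p)) (*-assoc p c′ d)))))

  -- A period Q of f yields the period gcd Q P dividing P = p ^ (1 + e); if it is
  -- a proper divisor it divides p ^ e, forcing f (p ^ e) ≡ f 0.
  primePower-minimalPeriod : ∀ {f e} → IsPeriod f (p ^ suc e) → f (p ^ e) ≢ f 0 →
                             IsMinimalPeriod f (p ^ suc e)
  primePower-minimalPeriod {f} {e} per@(_ , perP) f[p^e]≢f0 = per , minimal
    where
    minimal : ∀ Q → IsPeriod f Q → p ^ suc e ≤ Q
    minimal Q (1≤Q , perQ) with ∣p^[1+e]⇒≡p^[1+e]⊎∣p^e {e = e} (gcd[m,n]∣n Q (p ^ suc e))
    ... | inj₁ gcd≡P = subst (_≤ Q) gcd≡P (∣⇒≤ {{>-nonZero 1≤Q}} (gcd[m,n]∣m Q (p ^ suc e)))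
    ... | inj₂ (divides c p^e≡c*gcd) = contradiction
          (trans (cong f p^e≡c*gcd) (periodic-* (periodic-gcd perQ perP) c 0)) f[p^e]≢f0

module _ {n m : ℕ} where

  %-cong-modulus : ∀ {q r} .{{_ : NonZero q}} .{{_ : NonZero r}} → q ≡ r →
                   n % q ≡ m % q → n % r ≡ m % r
  %-cong-modulus refl n≡m = n≡m

  %-cong-∣ : ∀ {d q} .{{_ : NonZero d}} .{{_ : NonZero q}} → d ∣ q →
             n % q ≡ m % q → n % d ≡ m % d
  %-cong-∣ {d} {q} d∣q n≡m = begin
    n % d      ≡⟨ m∣n⇒o%n%m≡o%m d q n d∣q ⟨
    n % q % d  ≡⟨ cong (_% d) n≡m ⟩
    m % q % d  ≡⟨ m∣n⇒o%n%m≡o%m d q m d∣q ⟩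
    m % d      ∎
    where open ≡-Reasoning

  /-%-cong : ∀ {d q} .{{_ : NonZero d}} .{{_ : NonZero q}} .{{_ : NonZero (q * d)}} →
             n % (q * d) ≡ m % (q * d) → n / d % q ≡ m / d % q
  /-%-cong {d} {q} n≡m =
    trans (sym (m%[n*o]/o≡m/o%n n q d {{_}} {{_}} {{m*n≢0 q d}}))
      (trans (cong (_/ d) n≡m) (m%[n*o]/o≡m/o%n m q d {{_}} {{_}} {{m*n≢0 q d}}))

  *-%-cong : ∀ {d q} .{{_ : NonZero d}} .{{_ : NonZero q}} .{{_ : NonZero (d * q)}} →
             n % q ≡ m % q → d * n % (d * q) ≡ d * m % (d * q)
  *-%-cong {d} {q} n≡m = begin
    d * n % (d * q)  ≡⟨ cong (_% (d * q)) (*-comm d n) ⟩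
    n * d % (d * q)  ≡⟨ %-congʳ {{_}} {{m*n≢0 q d}} (*-comm d q) ⟩
    (n * d) %[q*d]   ≡⟨ m%n*o≡m*o%[n*o] n q d {{_}} {{m*n≢0 q d}} ⟨
    n % q * d        ≡⟨ cong (_* d) n≡m ⟩
    m % q * d        ≡⟨ m%n*o≡m*o%[n*o] m q d {{_}} {{m*n≢0 q d}} ⟩
    (m * d) %[q*d]   ≡⟨ %-congʳ {{m*n≢0 q d}} {{_}} (*-comm q d) ⟩
    m * d % (d * q)  ≡⟨ cong (_% (d * q)) (*-comm m d) ⟩
    d * m % (d * q)  ∎
    where
    open ≡-Reasoning
    _%[q*d] : ℕ → ℕ
    x %[q*d] = _%_ x (q * d) {{m*n≢0 q d}}

  +-%-cong : ∀ u {q} .{{_ : NonZero q}} → n % q ≡ m % q → (u + n) % q ≡ (u + m) % q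
  +-%-cong u {q} n≡m = begin
    (u + n) % q            ≡⟨ %-distribˡ-+ u n q ⟩
    (u % q + n % q) % q    ≡⟨ cong (λ x → (u % q + x) % q) n≡m ⟩
    (u % q + m % q) % q    ≡⟨ %-distribˡ-+ u m q ⟨
    (u + m) % q            ∎
    where open ≡-Reasoning

m≤n⇒x^m∣x^n : ∀ x {m n} → m ≤ n → x ^ m ∣ x ^ n
m≤n⇒x^m∣x^n x {m} {n} m≤n =
  divides (x ^ (n ∸ m)) (trans (cong (x ^_) (sym (m∸n+n≡m m≤n))) (^-distribˡ-+-* x (n ∸ m) m))

[x^m]^k*x^r≡x^[k*m+r] : ∀ x m k r → (x ^ m) ^ k * x ^ r ≡ x ^ (k * m + r)
[x^m]^k*x^r≡x^[k*m+r] x m k r = begin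
  (x ^ m) ^ k * x ^ r  ≡⟨ cong (_* x ^ r) (^-*-assoc x m k) ⟩
  x ^ (m * k) * x ^ r  ≡⟨ cong (λ e → x ^ e * x ^ r) (*-comm m k) ⟩
  x ^ (k * m) * x ^ r  ≡⟨ ^-distribˡ-+-* x (k * m) r ⟨
  x ^ (k * m + r)      ∎
  where open ≡-Reasoning

ceilDiv≡1+[a∸1]/b : ∀ a b .{{_ : NonZero b}} → 1 ≤ a → ceilDiv a b ≡ suc ((a ∸ 1) / b)
ceilDiv≡1+[a∸1]/b a b 1≤a = begin
  (a + b ∸ 1) / b        ≡⟨ cong (_/ b) (+-∸-comm b 1≤a) ⟩
  (a ∸ 1 + b) / b        ≡⟨ +-distrib-/-∣ʳ (a ∸ 1) ∣-refl ⟩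
  (a ∸ 1) / b + b / b    ≡⟨ cong ((a ∸ 1) / b +_) (n/n≡1 b) ⟩
  (a ∸ 1) / b + 1        ≡⟨ +-comm _ 1 ⟩
  suc ((a ∸ 1) / b)      ∎
  where open ≡-Reasoning

[a∸1]/b*b+1+[a∸1]%b≡a : ∀ a b .{{_ : NonZero b}} → 1 ≤ a → (a ∸ 1) / b * b + suc ((a ∸ 1) % b) ≡ a
[a∸1]/b*b+1+[a∸1]%b≡a a b 1≤a = begin
  (a ∸ 1) / b * b + suc ((a ∸ 1) % b)  ≡⟨ +-suc _ _ ⟩
  suc ((a ∸ 1) / b * b + (a ∸ 1) % b)  ≡⟨ cong suc (+-comm _ ((a ∸ 1) % b)) ⟩
  suc ((a ∸ 1) % b + (a ∸ 1) / b * b)  ≡⟨ cong suc (m≡m%n+[m/n]*n (a ∸ 1) b) ⟨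
  suc (a ∸ 1)                          ≡⟨ m+[n∸m]≡n 1≤a ⟩
  a                                    ∎
  where open ≡-Reasoning

a*[1+k]∸b*k≡1+k*a+r : ∀ {a b k r} → k * b + suc r ≡ a → a * suc k ∸ b * k ≡ suc (k * a + r)
a*[1+k]∸b*k≡1+k*a+r {a} {b} {k} {r} kb+[1+r]≡a = begin
  a * suc k ∸ b * k                    ≡⟨ cong (_∸ b * k) (trans (*-suc a k) (cong (a +_) (*-comm a k))) ⟩
  a + k * a ∸ b * k                    ≡⟨ cong (λ x → x + k * a ∸ b * k) kb+[1+r]≡a ⟨
  k * b + suc r + k * a ∸ b * k        ≡⟨ cong (_∸ b * k) (solve 4 (λ k b r x → k :* b :+ (con 1 :+ r) :+ x := b :* k :+ (con 1 :+ (x :+ r))) refl k b r (k * a)) ⟩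
  b * k + suc (k * a + r) ∸ b * k      ≡⟨ m+n∸m≡n (b * k) _ ⟩
  suc (k * a + r)                      ∎
  where open ≡-Reasoning

module _ (M N : ℕ) {{_ : NonZero M}} where

  baseShiftFuel-zero : ∀ f → baseShiftFuel M N f 0 ≡ 0
  baseShiftFuel-zero zero    = refl
  baseShiftFuel-zero (suc f) = begin
    0 % M + N * baseShiftFuel M N f (0 / M)  ≡⟨ cong (λ x → 0 % M + N * baseShiftFuel M N f x) (0/n≡0 M) ⟩
    0 % M + N * baseShiftFuel M N f 0        ≡⟨ cong (λ x → 0 % M + N * x) (baseShiftFuel-zero f) ⟩
    0 % M + N * 0                            ≡⟨ cong₂ _+_ (m<n⇒m%n≡m (>-nonZero⁻¹ M)) (*-zeroʳ N) ⟩
    0                                        ∎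
    where open ≡-Reasoning

  -- Each step divides by M.
  baseShiftFuel-stable : 1 < M → ∀ {f g n} → n ≤ f → n ≤ g →
                         baseShiftFuel M N f n ≡ baseShiftFuel M N g n
  baseShiftFuel-stable 1<M {zero}  {g}     {zero} _ _ = sym (baseShiftFuel-zero g)
  baseShiftFuel-stable 1<M {suc f} {zero}  {zero} _ _ = baseShiftFuel-zero (suc f)
  baseShiftFuel-stable 1<M {suc f} {suc g} {n} n≤1+f n≤1+g =
    cong (λ x → n % M + N * x) (baseShiftFuel-stable 1<M (/M≤ n≤1+f) (/M≤ n≤1+g))
    where
    /M≤ : ∀ {m h} → m ≤ suc h → m / M ≤ h
    /M≤ {zero}  {h} _       = subst (_≤ h) (sym (0/n≡0 M)) z≤n
    /M≤ {suc m} {h} m≤1+h = ≤-pred (≤-trans (m/n<m (suc m) M 1<M) m≤1+h)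

  baseShiftFuel-*M : ∀ f n → baseShiftFuel M N (suc f) (n * M) ≡ N * baseShiftFuel M N f n
  baseShiftFuel-*M f n = begin
    n * M % M + N * baseShiftFuel M N f (n * M / M)  ≡⟨ cong₂ (λ x y → x + N * baseShiftFuel M N f y) (m*n%n≡0 n M) (m*n/n≡m n M) ⟩
    N * baseShiftFuel M N f n                        ∎
    where open ≡-Reasoning

  baseShiftFuel-M^k*digit : ∀ {r} → r < M → ∀ k f → baseShiftFuel M N (suc k + f) (M ^ k * r) ≡ N ^ k * r
  baseShiftFuel-M^k*digit {r} r<M zero f = begin
    baseShiftFuel M N (suc f) (1 * r)          ≡⟨ cong (baseShiftFuel M N (suc f)) (*-identityˡ r) ⟩
    r % M + N * baseShiftFuel M N f (r / M)    ≡⟨ cong₂ (λ x y → x + N * baseShiftFuel M N f y) (m<n⇒m%n≡m r<M) (m<n⇒m/n≡0 r<M) ⟩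
    r + N * baseShiftFuel M N f 0              ≡⟨ cong (λ x → r + N * x) (baseShiftFuel-zero f) ⟩
    r + N * 0                                  ≡⟨ trans (cong (r +_) (*-zeroʳ N)) (+-identityʳ r) ⟩
    r                                          ≡⟨ *-identityˡ r ⟨
    1 * r                                      ∎
    where open ≡-Reasoning
  baseShiftFuel-M^k*digit {r} r<M (suc k) f = begin
    baseShiftFuel M N (suc (suc k + f)) (M * M ^ k * r)  ≡⟨ cong (baseShiftFuel M N (suc (suc k + f))) (trans (*-assoc M (M ^ k) r) (*-comm M (M ^ k * r))) ⟩
    baseShiftFuel M N (suc (suc k + f)) (M ^ k * r * M)  ≡⟨ baseShiftFuel-*M (suc k + f) (M ^ k * r) ⟩
    N * baseShiftFuel M N (suc k + f) (M ^ k * r)        ≡⟨ cong (N *_) (baseShiftFuel-M^k*digit r<M k f) ⟩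
    N * (N ^ k * r)                                      ≡⟨ *-assoc N (N ^ k) r ⟨
    N * N ^ k * r                                        ∎
    where open ≡-Reasoning

  baseShift-M^k*digit : 1 < M → ∀ {r} → r < M → ∀ k → baseShift M N (M ^ k * r) ≡ N ^ k * r
  baseShift-M^k*digit 1<M r<M k =
    trans (baseShiftFuel-stable 1<M ≤-refl (m≤n+m _ (suc k))) (baseShiftFuel-M^k*digit r<M k _)

  baseShiftFuel-%-∣ : ∀ {S} .{{_ : NonZero S}} → S ∣ M → S ∣ N → ∀ f n →
                      baseShiftFuel M N (suc f) n % S ≡ n % S
  baseShiftFuel-%-∣ {S} S∣M S∣N f n = begin
    (n % M + N * baseShiftFuel M N f (n / M)) % S  ≡⟨ %-remove-+ʳ (n % M) (∣m⇒∣m*n _ S∣N) ⟩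
    n % M % S                                      ≡⟨ m∣n⇒o%n%m≡o%m S M n S∣M ⟩
    n % S                                          ∎
    where open ≡-Reasoning

  -- Digit i of n lands in the N ^ i position, so agreement of n and m modulo
  -- M ^ k * S (the first k digits, and the next one modulo S) carries over to
  -- agreement of the images modulo N ^ k * S.
  baseShiftFuel-%-cong : ∀ {S} → S ∣ M → S ∣ N → {{_ : NonZero N}} →
    ∀ k .{{_ : NonZero (M ^ k * S)}} .{{_ : NonZero (N ^ k * S)}} → ∀ f {n m} →
    n % (M ^ k * S) ≡ m % (M ^ k * S) →
    baseShiftFuel M N f n % (N ^ k * S) ≡ baseShiftFuel M N f m % (N ^ k * S)
  baseShiftFuel-%-cong _ _ k zero _ = refl
  baseShiftFuel-%-cong {S} S∣M S∣N zero (suc f) {n} {m} n≡m =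
    %-cong-modulus {{nzS}} (sym (*-identityˡ S))
      (trans (baseShiftFuel-%-∣ {{nzS}} S∣M S∣N f n)
        (trans (%-cong-modulus {{_}} {{nzS}} (*-identityˡ S) n≡m)
          (sym (baseShiftFuel-%-∣ {{nzS}} S∣M S∣N f m))))
    where nzS = m*n≢0⇒n≢0 1
  baseShiftFuel-%-cong {S} S∣M S∣N (suc k) (suc f) {n} {m} n≡m =
    %-cong-modulus (sym (*-assoc N (N ^ k) S))
      (trans (cong (λ x → (x + N * baseShiftFuel M N f (n / M)) % (N * U)) low)
        (+-%-cong (m % M) {N * U} (*-%-cong {d = N} {q = U} (baseShiftFuel-%-cong S∣M S∣N k f high))))
    where
    T = M ^ k * S
    U = N ^ k * S
    instance
      nzS : NonZero S
      nzS = m*n≢0⇒n≢0 (M ^ suc k)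
      nzT : NonZero T
      nzT = m*n≢0 (M ^ k) S {{m^n≢0 M k}}
      nzU : NonZero U
      nzU = m*n≢0 (N ^ k) S {{m^n≢0 N k}}
      nzTM : NonZero (T * M)
      nzTM = m*n≢0 T M
      nzNU : NonZero (N * U)
      nzNU = m*n≢0 N U
    n≡m[T*M] : n % (T * M) ≡ m % (T * M)
    n≡m[T*M] = %-cong-modulus (trans (*-assoc M (M ^ k) S) (*-comm M T)) n≡m
    low : n % M ≡ m % M
    low = %-cong-∣ {d = M} {q = T * M} (n∣m*n T) n≡m[T*M]
    high : n / M % T ≡ m / M % T
    high = /-%-cong {d = M} {q = T} n≡m[T*M]

  baseShift-%-periodic : 1 < M → ∀ {S} → S ∣ M → S ∣ N → {{_ : NonZero N}} →
    ∀ k .{{_ : NonZero (M ^ k * S)}} .{{_ : NonZero (N ^ k * S)}} →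
    Periodic (λ n → baseShift M N n % (N ^ k * S)) (M ^ k * S)
  baseShift-%-periodic 1<M {S} S∣M S∣N k n = begin
    baseShiftFuel M N (n + P) (n + P) % R  ≡⟨ baseShiftFuel-%-cong S∣M S∣N k (n + P) ([m+n]%n≡m%n n P) ⟩
    baseShiftFuel M N (n + P) n % R        ≡⟨ cong (_% R) (baseShiftFuel-stable 1<M (m≤m+n n P) ≤-refl) ⟩
    baseShiftFuel M N n n % R              ∎
    where
    open ≡-Reasoning
    P = M ^ k * S
    R = N ^ k * S

baseShift-primePower-minimalPeriod : ∀ {p} → Prime p → ∀ {a b k r} → k * b + suc r ≡ a → r < b →
  .{{_ : NonZero (p ^ a)}} →
  IsMinimalPeriod (λ n → baseShift (p ^ a) (p ^ b) n % p ^ a) (p ^ suc (k * a + r))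
baseShift-primePower-minimalPeriod {p} prime-p {a} {b} {k} {r} kb+[1+r]≡a r<b =
  primePower-minimalPeriod prime-p {e = k * a + r} (m^n>0 p (suc (k * a + r)) , periodic) g[p^[ka+r]]≢g0
  where
  instance
    nzp : NonZero p
    nzp = prime⇒nonZero prime-p
    nzN : NonZero (p ^ b)
    nzN = m^n≢0 p b
    nzMkS : NonZero ((p ^ a) ^ k * p ^ suc r)
    nzMkS = m*n≢0 _ _ {{m^n≢0 (p ^ a) k}} {{m^n≢0 p (suc r)}}
    nzNkS : NonZero ((p ^ b) ^ k * p ^ suc r)
    nzNkS = m*n≢0 _ _ {{m^n≢0 (p ^ b) k}} {{m^n≢0 p (suc r)}}
  nzM : NonZero (p ^ a)
  nzM = m^n≢0 p a
  g : ℕ → ℕ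
  g n = baseShift (p ^ a) (p ^ b) n % p ^ a
  1<p : 1 < p
  1<p = nonTrivial⇒n>1 p {{prime⇒nonTrivial prime-p}}
  kb+r<a : k * b + r < a
  kb+r<a = ≤-reflexive (trans (sym (+-suc (k * b) r)) kb+[1+r]≡a)
  1<M : 1 < p ^ a
  1<M = ^-monoʳ-< p 1<p (≤-trans (s≤s z≤n) kb+r<a)
  1+r≤a : suc r ≤ a
  1+r≤a = ≤-trans (s≤s (m≤n+m r (k * b))) kb+r<a
  periodic : Periodic g (p ^ suc (k * a + r))
  periodic = subst (Periodic g)
    (trans ([x^m]^k*x^r≡x^[k*m+r] p a k (suc r)) (cong (p ^_) (+-suc (k * a) r)))
    λ n → %-cong-modulus N^kS≡M
            (baseShift-%-periodic (p ^ a) (p ^ b) {{nzM}} 1<M (m≤n⇒x^m∣x^n p 1+r≤a) (m≤n⇒x^m∣x^n p r<b) k n)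
    where
    N^kS≡M : (p ^ b) ^ k * p ^ suc r ≡ p ^ a
    N^kS≡M = trans ([x^m]^k*x^r≡x^[k*m+r] p b k (suc r)) (cong (p ^_) kb+[1+r]≡a)
  g[p^[ka+r]]≡p^[kb+r] : g (p ^ (k * a + r)) ≡ p ^ (k * b + r)
  g[p^[ka+r]]≡p^[kb+r] =
    trans (cong g (sym ([x^m]^k*x^r≡x^[k*m+r] p a k r)))
      (trans (cong (_% p ^ a) (baseShift-M^k*digit (p ^ a) (p ^ b) {{nzM}} 1<M (^-monoʳ-< p 1<p 1+r≤a) k))
        (trans (cong (_% p ^ a) ([x^m]^k*x^r≡x^[k*m+r] p b k r))
          (m<n⇒m%n≡m (^-monoʳ-< p 1<p kb+r<a))))
  g[p^[ka+r]]≢g0 : g (p ^ (k * a + r)) ≢ g 0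
  g[p^[ka+r]]≢g0 eq = >⇒≢ (m^n>0 p (k * b + r))
    (trans (sym g[p^[ka+r]]≡p^[kb+r]) (trans eq (m<n⇒m%n≡m (m^n>0 p a))))

theorem2p2 : (p a b : ℕ) → Prime p → 1 ≤ a → 1 ≤ b →
    .{{_ : NonZero (p ^ a)}} → .{{_ : NonZero b}} →
    let M = p ^ a
        N = p ^ b
        t = ceilDiv a b
        e = a * t ∸ b * (t ∸ 1)
    in IsMinimalPeriod (λ n → baseShift M N n % M) (p ^ e)
theorem2p2 p a b prime-p 1≤a _ =
  subst (λ t → IsMinimalPeriod g (p ^ (a * t ∸ b * (t ∸ 1)))) (sym (ceilDiv≡1+[a∸1]/b a b 1≤a))
    (subst (λ e → IsMinimalPeriod g (p ^ e)) (sym (a*[1+k]∸b*k≡1+k*a+r {b = b} {k} kb+[1+r]≡a))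
      (baseShift-primePower-minimalPeriod prime-p {b = b} {k} kb+[1+r]≡a (m%n<n (a ∸ 1) b)))
  where
  g : ℕ → ℕ
  g n = baseShift (p ^ a) (p ^ b) n % p ^ a
  k : ℕ
  k = (a ∸ 1) / b
  kb+[1+r]≡a : k * b + suc ((a ∸ 1) % b) ≡ a
  kb+[1+r]≡a = [a∸1]/b*b+1+[a∸1]%b≡a a b 1≤a
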